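{- Let $k\in\mathbb{N}$, $E\subseteq W(A)$ and $\vec s=(s_n(x))_{n=0}^\infty\in V^\infty(A)$ be such that $E$ is $k$-large in $\vec s$. Let $\vec w=(w_n(x))_{n=0}^\infty$ be a sequence of variable words and $(k_n)_{n=0}^\infty$, $(p_n)_{n=0}^\infty$ strictly increasing sequences in $\mathbb{N}$ with $k_0=k$, $p_0=0$, and set $F_n=\langle(w_i(x))_{i=0}^n\parallel(A_{k_i})_{i=0}^n\rangle_c$; assume that for every $n\in\mathbb{N}$: (S1) $k+p_n\geq k_n$; (S2) $w_n(x)\in\langle(s_i(x))_{i=p_n}^{p_{n+1}-1}\parallel(A_{k+i})_{i=p_n}^{p_{n+1}-1}\rangle_v$; (S3) $E\cap E_{F_n}$ is $k_{n+1}$-large in $(w_i(x))_{i=n+1}^\infty$. Then there exist a strictly increasing sequence $(r_n)_{n=0}^\infty$ in $\mathbb{N}$ with $r_0=0$ and a sequence $\vec t=(t_n(x))_{n=0}^\infty$ of variable words such that for every $n\geq1$: (T1) $t_n(x)\in\langle(w_{r_n+i}(x))_{i=0}^{r_{n+1}-r_n-1}\parallel(A_{k_{r_n+i}})_{i=0}^{r_{n+1}-r_n-1}\rangle_v$; (T2) for every $a\in A_{k_{r_n}}$ we have $t_n(a)\in E$, and $u\,t_n(a)\in E$ for every $u\in\langle(t_i(x))_{i=0}^{n-1}\parallel(A_{k_{r_i}})_{i=0}^{n-1}\rangle_c$; (T3) $\langle(t_i(x))_{i=0}^n\parallel(A_{k_{r_i}})_{i=0}^n\rangle_c\subseteq 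F_{r_{n+1}-1}$.
   Context: $\mathbb{N}=\{0,1,2,\dots\}$. Fix an increasing sequence $A_0\subseteq A_1\subseteq\cdots$ of nonempty finite sets and let $A=\bigcup_nA_n$. $W(A)$ is the set of finite words over $A$ (including the empty word); words are concatenated by juxtaposition. Fix a symbol $x\notin A$. A variable word is a finite word over $A\cup\{x\}$ containing $x$ at least once; $V(A)$ is the set of variable words and $V^\infty(A)$ the set of infinite sequences of variable words. For $s(x)\in V(A)$ and $a\in A\cup\{x\}$, $s(a)$ replaces every occurrence of $x$ by $a$. For variable words $(s_n(x))_{n=p}^q$ and nonempty $B_p,\dots,B_q\subseteq A$, $\langle(s_n(x))_{n=p}^q\parallel(B_n)_{n=p}^q\rangle_c$ is the set of all words $s_{l_0}(a_0)\cdots s_{l_j}(a_j)$ with $j\ge0$, $p\le l_0<\dots<l_j\le q$, $a_i\in B_{l_i}$, and $\langle(s_n(x))_{n=p}^q\parallel(B_n)_{n=p}^q\rangle_v=V(A)\cap\langle(s_n(x))_{n=p}^q\parallel(B_n\cup\{x\})_{n=p}^q\rangle_c$. For infinite $\vec s=(s_n(x))_{n=0}^\infty$, $\langle\vec s\parallel(B_n)_{n=0}^\infty\rangle_c=\bigcup_m\langle(s_n(x))_{n=0}^m\parallel(B_n)_{n=0}^m\rangle_c$. For $j\in\mathbb{N}$, a finite sequence $(t_n(x))_{n=0}^l$ is an extracted $j$-block subsequence of $\vec s$ if there are $0=m_0<\dots<m_{l+1}$ with $t_i(x)\in\langle(s_n(x))_{n=m_i}^{m_{i+1}-1}\parallel(A_{j+n})_{n=m_i}^{m_{i+1}-1}\rangle_v$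 for $0\le i\le l$; an infinite sequence is an extracted $j$-block subsequence if all its finite initial segments are. A tail $(w_i(x))_{i=m}^\infty$ is regarded as the sequence $(w_{m+i}(x))_{i=0}^\infty$. $E\subseteq W(A)$ is $j$-large in $\vec s$ if $E\cap\langle\vec w\parallel(A_{j+n})_{n=0}^\infty\rangle_c\neq\emptyset$ for every infinite extracted $j$-block subsequence $\vec w$ of $\vec s$. For nonempty $E,F\subseteq W(A)$, $E_F=\{z\in W(A):wz\in E\text{ for every }w\in F\}$. -}

module Defs where

open import Data.Nat using (ℕ; zero; suc; _+_; _∸_; _≤_; _<_)
open import Data.List using (List; []; _∷_; _++_; map)
open import Data.List.Membership.Propositional using (_∈_)
open import Data.List.Relation.Unary.Any using (Any)
open import Data.Maybe using (Maybe; just; nothing)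
open import Data.Product using (Σ; ∃; _×_; _,_)
open import Data.Sum using (_⊎_)
open import Relation.Binary.PropositionalEquality using (_≡_)

StrictInc : (ℕ → ℕ) → Set
StrictInc f = ∀ n → f n < f (suc n)

module _ {Alph : Set} where

  -- Letters of A ∪ {x}; the variable x is `nothing`.
  Letter : Set
  Letter = Maybe Alph

  Word : Set
  Word = List Alph

  LWord : Set
  LWord = List Letter

  IsVar : LWord → Set
  IsVar w = Any (_≡ nothing) w

  substL : Letter → Letter → Letter
  substL c nothing = c
  substL c (just a) = just a

  sub : LWord → Letter → LWord
  sub w c = map (substL c) w

  substA : Alph → Letter → Alph
  substA a nothing = a
  substA a (just b) = b

  subA : LWord → Alph → Word
  subA w a = map (substA a) w

  -- Span s B p q : the set of words s_{l0}(c0) ... s_{lj}(cj) with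
  -- j ≥ 0, p ≤ l0 < ... < lj ≤ q, c_i satisfying B l_i.
  data Span (s : ℕ → LWord) (B : ℕ → Letter → Set) : ℕ → ℕ → LWord → Set where
    last : ∀ {p q l c} → p ≤ l → l ≤ q → B l c → Span s B p q (sub (s l) c)
    step : ∀ {p q l c w} → p ≤ l → B l c → Span s B (suc l) q w →
           Span s B p q (sub (s l) c ++ w)

  InA : List Alph → Letter → Set
  InA B c = ∃ λ a → c ≡ just a × a ∈ B

  -- ⟨(s_n)_{n=p}^q ∥ (B_n)_{n=p}^q⟩_c, as a subset of W(A)
  SpanC : (ℕ → LWord) → (ℕ → List Alph) → ℕ → ℕ → Word → Set
  SpanC s B p q u = Span s (λ n → InA (B n)) p q (map just u)

  -- ⟨(s_n)_{n=p}^q ∥ (B_n)_{n=p}^q⟩_v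
  SpanV : (ℕ → LWord) → (ℕ → List Alph) → ℕ → ℕ → LWord → Set
  SpanV s B p q w = IsVar w × Span s (λ n c → c ≡ nothing ⊎ InA (B n) c) p q w

  -- ⟨s ∥ (B_n)_{n=0}^∞⟩_c
  SpanCInf : (ℕ → LWord) → (ℕ → List Alph) → Word → Set
  SpanCInf s B u = ∃ λ m → SpanC s B 0 m u

  -- tail (w_i)_{i=m}^∞ regarded as (w_{m+i})_{i=0}^∞
  tail : ℕ → (ℕ → LWord) → (ℕ → LWord)
  tail m w i = w (m + i)

  Restrict : (Word → Set) → (Word → Set) → Word → Set
  Restrict E F z = ∀ w → F w → E (w ++ z)

  module _ (As : ℕ → List Alph) where

    FinExtracted : ℕ → (ℕ → LWord) → (ℕ → LWord) → ℕ → Set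
    FinExtracted j s t l =
      ∃ λ (m : ℕ → ℕ) → m 0 ≡ 0 × (∀ i → i ≤ l → m i < m (suc i)) ×
        (∀ i → i ≤ l → SpanV s (λ n → As (j + n)) (m i) (m (suc i) ∸ 1) (t i))

    Extracted : ℕ → (ℕ → LWord) → (ℕ → LWord) → Set
    Extracted j s t = ∀ l → FinExtracted j s t l

    Large : (Word → Set) → ℕ → (ℕ → LWord) → Set
    Large E j s = ∀ t → Extracted j s t →
      ∃ λ u → E u × SpanCInf t (λ n → As (j + n)) u

-- For each p, hypothesis (S3) applied to the tail (w_i)_{i>p} itself, which is
-- trivially an extracted block subsequence of itself, yields a word z_p in
-- ⟨(w_i)_{i=p+1}^{p+m_p} ∥ (A_{k_i})⟩_c with F_p z_p ⊆ E.  Take r_0 = 0,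
-- r_{n+1} = r_n + m_{r_n} + 2 and t_n = w_{r_n} z_{r_n}.  Then t_n occupies the block
-- [r_n, r_{n+1} - 1] of w, so every u ∈ ⟨(t_i)_{i<n}⟩_c lies in F_{r_n - 1}; hence
-- u w_{r_n}(a) and w_{r_n}(a) lie in F_{r_n}, and appending z_{r_n} lands in E.
-- Only (S3) is used.
module Submission where

open import Defs
open import Data.Nat using (ℕ; zero; suc; _+_; _∸_; _≤_; _≤′_; ≤′-reflexive; ≤′-step; z≤n; s≤s)
open import Data.Nat.Properties
open import Data.List using (List; _++_; map)
open import Data.List.Properties using (map-id; map-∘; map-cong; map-++; ++-assoc)
open import Data.List.Membership.Propositional using (_∈_)
open import Data.List.Relation.Unary.Any.Properties using (++⁺ˡ)
open import Data.Maybe using (just; nothing)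
open import Data.Product using (∃; _×_; _,_; proj₁; proj₂)
open import Data.Sum using (inj₁; inj₂)
open import Function using (id)
open import Relation.Binary.PropositionalEquality

stepwise : ∀ {ℓ} (P : ℕ → Set ℓ) → (∀ n → P n → P (suc n)) → ∀ {m n} → m ≤ n → P m → P n
stepwise P up m≤n = go (≤⇒≤′ m≤n)
  where
  go : ∀ {m n} → m ≤′ n → P m → P n
  go (≤′-reflexive refl) pm = pm
  go (≤′-step m≤n)       pm = up _ (go m≤n pm)

strictInc⇒mono : ∀ {f} → StrictInc f → ∀ {m n} → m ≤ n → f m ≤ f n
strictInc⇒mono {f} inc {m} m≤n =
  stepwise (λ n → f m ≤ f n) (λ n fm≤fn → ≤-trans fm≤fn (<⇒≤ (inc n))) m≤n ≤-refl

strictInc-+-≤ : ∀ {f} → StrictInc f → ∀ d i → f d + i ≤ f (d + i)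
strictInc-+-≤ {f} inc d zero =
  ≤-reflexive (trans (+-identityʳ (f d)) (cong f (sym (+-identityʳ d))))
strictInc-+-≤ {f} inc d (suc i) = begin
  f d + suc i      ≡⟨ +-suc (f d) i ⟩
  suc (f d + i)    ≤⟨ s≤s (strictInc-+-≤ inc d i) ⟩
  suc (f (d + i))  ≤⟨ inc (d + i) ⟩
  f (suc (d + i))  ≡⟨ cong f (sym (+-suc d i)) ⟩
  f (d + suc i)    ∎
  where open ≤-Reasoning

module _ {Alph : Set} where

  sub-x : (v : LWord {Alph}) → sub v nothing ≡ v
  sub-x v = trans (map-cong substL-x v) (map-id v)
    where
    substL-x : ∀ c → substL nothing c ≡ c
    substL-x nothing  = refl
    substL-x (just a) = refl

  map-just-subA : (v : LWord {Alph}) (a : Alph) → map just (subA v a) ≡ sub v (just a)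
  map-just-subA v a = trans (sym (map-∘ v)) (map-cong just-substA v)
    where
    just-substA : ∀ c → just (substA a c) ≡ substL (just a) c
    just-substA nothing  = refl
    just-substA (just b) = refl

  sub-++-constant : (v : LWord {Alph}) (z : Word) (c : Letter) →
    sub (v ++ map just z) c ≡ sub v c ++ map just z
  sub-++-constant v z c = trans (map-++ (substL c) v (map just z))
    (cong (sub v c ++_) (sym (map-∘ z)))

  subA-++-constant : (v : LWord {Alph}) (z : Word) (a : Alph) →
    subA (v ++ map just z) a ≡ subA v a ++ z
  subA-++-constant v z a = trans (map-++ (substA a) v (map just z))
    (cong (subA v a ++_) (trans (sym (map-∘ z)) (map-id z)))

  span-widen : ∀ {s B p p′ q q′ U} → p′ ≤ p → q ≤ q′ →
    Span {Alph} s B p q U → Span s B p′ q′ U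
  span-widen p′≤p q≤q′ (last p≤l l≤q b) =
    last (≤-trans p′≤p p≤l) (≤-trans l≤q q≤q′) b
  span-widen p′≤p q≤q′ (step p≤l b r) =
    step (≤-trans p′≤p p≤l) b (span-widen ≤-refl q≤q′ r)

  span-weaken : ∀ {s B B′ p q U} → (∀ i c → B i c → B′ i c) →
    Span {Alph} s B p q U → Span s B′ p q U
  span-weaken f (last p≤l l≤q b) = last p≤l l≤q (f _ _ b)
  span-weaken f (step p≤l b r)   = step p≤l (f _ _ b) (span-weaken f r)

  span-++ : ∀ {s B p q q′ U V} → Span {Alph} s B p q U → Span s B (suc q) q′ V →
    Span s B p q′ (U ++ V)
  span-++ (last p≤l l≤q b) sv = step p≤l b (span-widen (s≤s l≤q) ≤-refl sv)
  span-++ {s} {B} {p} {q′ = q′} {V = V} (step {l = l} {c = c} {w = U} p≤l b r) sv =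
    subst (Span s B p q′) (sym (++-assoc (sub (s l) c) U V)) (step p≤l b (span-++ r sv))

  span-tail : ∀ {s B B′ p q U} d → (∀ i c → B′ i c → B (d + i) c) →
    Span {Alph} (tail d s) B′ p q U → Span s B (d + p) (d + q) U
  span-tail d f (last p≤l l≤q b) = last (+-monoʳ-≤ d p≤l) (+-monoʳ-≤ d l≤q) (f _ _ b)
  span-tail {s} {B} {q = q} d f (step {l = l} {w = U} p≤l b r) =
    step (+-monoʳ-≤ d p≤l) (f _ _ b)
      (subst (λ p → Span s B p (d + q) U) (+-suc d l) (span-tail d f r))

  spanC-letter : ∀ {s Bs a} p → a ∈ Bs p → SpanC {Alph} s Bs 0 p (subA (s p) a)
  spanC-letter {s} {Bs} {a} p a∈ =
    subst (Span s _ 0 p) (sym (map-just-subA (s p) a)) (last z≤n ≤-refl (a , refl , a∈))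

  spanC-snoc : ∀ {s Bs p q a u} → SpanC {Alph} s Bs p q u → a ∈ Bs (suc q) →
    SpanC s Bs p (suc q) (u ++ subA (s (suc q)) a)
  spanC-snoc {s} {Bs} {p} {q} {a} {u} us a∈ =
    subst (Span s _ p (suc q))
      (sym (trans (map-++ just u _)
                  (cong (map just u ++_) (map-just-subA (s (suc q)) a))))
      (span-++ us (last ≤-refl ≤-refl (a , refl , a∈)))

  module _ (As : ℕ → List Alph) where

    extracted-self : ∀ j s → (∀ n → IsVar (s n)) → Extracted As j s s
    extracted-self j s var l = id , refl , (λ i _ → ≤-refl) , λ i _ →
      var i , subst (Span s _ i i) (sub-x (s i)) (last ≤-refl ≤-refl (inj₁ refl))

    large-witness : ∀ {E j s} → (∀ n → IsVar (s n)) → Large As E j s →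
      ∃ λ z → E z × SpanCInf s (λ n → As (j + n)) z
    large-witness {j = j} {s} var large = large s (extracted-self j s var)

  module Blocks (Bs : ℕ → List Alph) (E : Word → Set)
    (w : ℕ → LWord) (var : ∀ n → IsVar (w n)) (m : ℕ → ℕ) (z : ℕ → Word)
    (z-restrict : ∀ p → Restrict E (SpanC w Bs 0 p) (z p))
    (z-span : ∀ p → Span w (λ i → InA (Bs i)) (suc p) (suc p + m p) (map just (z p))) where

    r : ℕ → ℕ
    r zero    = 0
    r (suc n) = suc (suc (r n + m (r n)))

    t : ℕ → LWord
    t n = w (r n) ++ map just (z (r n))

    r-inc : StrictInc r
    r-inc n = s≤s (≤-trans (m≤m+n (r n) (m (r n))) (n≤1+n _))

    t-var : ∀ n → IsVar (t n)
    t-var n = ++⁺ˡ (var (r n))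

    t-block : ∀ {B} n c → B (r n) c → (∀ i c → InA (Bs i) c → B i c) →
      Span w B (r n) (r (suc n) ∸ 1) (sub (t n) c)
    t-block n c b inA⇒B = subst (Span w _ (r n) (r (suc n) ∸ 1))
      (sym (sub-++-constant (w (r n)) (z (r n)) c))
      (step ≤-refl b (span-weaken inA⇒B (z-span (r n))))

    t-spanV : ∀ n → SpanV w Bs (r n) (r (suc n) ∸ 1) (t n)
    t-spanV n = t-var n ,
      subst (Span w _ (r n) (r (suc n) ∸ 1)) (sub-x (t n))
        (t-block n nothing (inj₁ refl) (λ _ _ → inj₂))

    span-t⊆span-w : ∀ {p q U} → Span t (λ i → InA (Bs (r i))) p q U →
      Span w (λ i → InA (Bs i)) (r p) (r (suc q) ∸ 1) U
    span-t⊆span-w (last {l = l} p≤l l≤q b@(_ , refl , _)) =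
      span-widen (strictInc⇒mono r-inc p≤l) (∸-monoˡ-≤ 1 (strictInc⇒mono r-inc (s≤s l≤q)))
        (t-block l _ b (λ _ _ → id))
    span-t⊆span-w (step {l = l} p≤l b@(_ , refl , _) rest) =
      span-widen (strictInc⇒mono r-inc p≤l) ≤-refl
        (span-++ (t-block l _ b (λ _ _ → id)) (span-t⊆span-w rest))

    t-letter∈E : ∀ n a → a ∈ Bs (r n) → E (subA (t n) a)
    t-letter∈E n a a∈ = subst E (sym (subA-++-constant (w (r n)) (z (r n)) a))
      (z-restrict (r n) _ (spanC-letter (r n) a∈))

    t-after-span∈E : ∀ n a → a ∈ Bs (r (suc n)) →
      ∀ u → SpanC t (λ i → Bs (r i)) 0 n u → E (u ++ subA (t (suc n)) a)
    t-after-span∈E n a a∈ u us =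
      subst E (trans (++-assoc u _ _)
                     (cong (u ++_) (sym (subA-++-constant (w (r (suc n))) (z (r (suc n))) a))))
        (z-restrict (r (suc n)) _ (spanC-snoc (span-t⊆span-w us) a∈))

lemma37 : {Alph : Set} (As : ℕ → List Alph) →
  (∀ n → ∃ λ a → a ∈ As n) →
  (∀ n {a} → a ∈ As n → a ∈ As (suc n)) →
  (∀ a → ∃ λ n → a ∈ As n) →
  (k : ℕ) (E : Word → Set) (s : ℕ → LWord) →
  (∀ n → IsVar (s n)) →
  Large As E k s →
  (w : ℕ → LWord) → (∀ n → IsVar (w n)) →
  (kk pp : ℕ → ℕ) → StrictInc kk → StrictInc pp → kk 0 ≡ k → pp 0 ≡ 0 →
  (∀ n → kk n ≤ k + pp n) →
  (∀ n → SpanV s (λ i → As (k + i)) (pp n) (pp (suc n) ∸ 1) (w n)) →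
  (∀ n → Large As (λ z → E z × Restrict E (SpanC w (λ i → As (kk i)) 0 n) z)
               (kk (suc n)) (tail (suc n) w)) →
  ∃ λ (r : ℕ → ℕ) → ∃ λ (t : ℕ → LWord) →
    r 0 ≡ 0 × StrictInc r × (∀ n → IsVar (t n)) ×
    (∀ n → 1 ≤ n →
      SpanV w (λ i → As (kk i)) (r n) (r (suc n) ∸ 1) (t n) ×
      (∀ a → a ∈ As (kk (r n)) →
        E (subA (t n) a) ×
        (∀ u → SpanC t (λ i → As (kk (r i))) 0 (n ∸ 1) u → E (u ++ subA (t n) a))) ×
      (∀ u → SpanC t (λ i → As (kk (r i))) 0 n u →
        SpanC w (λ i → As (kk i)) 0 (r (suc n) ∸ 1) u))
lemma37 As _ up _ _ E _ _ _ w var kk _ kk-inc _ _ _ _ _ S3 =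
  r , t , refl , r-inc , t-var ,
  λ { zero ()
    ; (suc n) _ → t-spanV (suc n)
                , (λ a a∈ → t-letter∈E (suc n) a a∈ , t-after-span∈E n a a∈)
                , (λ _ → span-t⊆span-w) }
  where
  F : ℕ → Word → Set
  F = SpanC w (λ i → As (kk i)) 0

  witness : ∀ p → ∃ λ z → (E z × Restrict E (F p) z) ×
    SpanCInf (tail (suc p) w) (λ n → As (kk (suc p) + n)) z
  witness p = large-witness As (λ n → var (suc p + n)) (S3 p)

  m : ℕ → ℕ
  m p = proj₁ (proj₂ (proj₂ (witness p)))

  z : ℕ → Word
  z p = proj₁ (witness p)

  z-span : ∀ p → Span w (λ i → InA (As (kk i))) (suc p) (suc p + m p) (map just (z p))
  z-span p = span-widen (m≤m+n (suc p) 0) ≤-refl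
    (span-tail (suc p) kk-shift (proj₂ (proj₂ (proj₂ (witness p)))))
    where
    kk-shift : ∀ i c → InA (As (kk (suc p) + i)) c → InA (As (kk (suc p + i))) c
    kk-shift i c (a , c≡a , a∈) =
      a , c≡a , stepwise (λ n → a ∈ As n) (λ n → up n) (strictInc-+-≤ kk-inc (suc p) i) a∈

  open Blocks (λ i → As (kk i)) E w var m z (λ p → proj₂ (proj₁ (proj₂ (witness p)))) z-span
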